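{- Let $p$ be a permutation and let $w$ be its 3-stack word (a word over $\{A,B,C,D\}$). Then: (1) $w$ has no factor $BB$; (2) $w$ has no factor $CC$; (3) $w$ has no factor $BAB$; (4) for no integer $j\ge 0$ does $w$ have a factor $CBA^jC$ (a $C$, then a $B$, then $j$ copies of $A$, then a $C$). Here a factor means a set of consecutive letters of $w$.
   Context: Serial 3-stack algorithm: there are three stacks $S_1,S_2,S_3$ placed in series, each required to be increasing from top to bottom; $a_i$ denotes the entry on top of $S_i$. The entries of the input permutation $p=p_1\cdots p_n$ are read left to right. At each step: if the next input entry $x$ is smaller than $a_1$ (or $S_1$ is empty), $x$ is put on top of $S_1$ (move $A$). Otherwise, one finds the smallest $i\in\{1,2\}$ such that $a_i$ can move to the next stack (i.e. $S_{i+1}$ is empty or $a_i<a_{i+1}$) and moves $a_i$ onto $S_{i+1}$ (move $B$ if $i=1$, move $C$ if $i=2$). If no such $i$ exists, or if $S_1$, $S_2$ and the input have all been emptied, the entry on top of $S_3$ is moved to the output (move $D$). The 3-stack word of $p$ is the sequence of moves performed, a word of length $4n$ over $\{A,B,C,D\}$ containing $n$ copies of each letter. -}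

module Defs where

open import Data.Nat using (ℕ; zero; suc; _*_; _<?_)
open import Data.List using (List; []; _∷_; _++_; length)
open import Data.Product using (∃)
open import Relation.Binary.PropositionalEquality using (_≡_)
open import Relation.Nullary using (yes; no)

data Move : Set where
  A B C D : Move

-- A stack is a list whose head is the top entry.
Stack : Set
Stack = List ℕ

record Config : Set where
  constructor config
  field
    input : List ℕ
    s1 s2 s3 : Stack

data Step : Set where
  done : Step
  step : Move → Config → Step

moveBCD : List ℕ → Stack → Stack → Stack → Step
moveBCD inp s1 s2 s3 = tryB s1 s2
  where
  popD : Stack → Step
  popD []       = done
  popD (_ ∷ r3) = step D (config inp s1 s2 r3)

  tryD : Step
  tryD = popD s3

  tryC : Stack → Stack → Step
  tryC (a2 ∷ r2) [] = step C (config inp s1 r2 (a2 ∷ []))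
  tryC (a2 ∷ r2) (a3 ∷ r3) with a2 <? a3
  ... | yes _ = step C (config inp s1 r2 (a2 ∷ a3 ∷ r3))
  ... | no  _ = tryD
  tryC [] _ = tryD

  tryB : Stack → Stack → Step
  tryB (a1 ∷ r1) [] = step B (config inp r1 (a1 ∷ []) s3)
  tryB (a1 ∷ r1) (a2 ∷ r2) with a1 <? a2
  ... | yes _ = step B (config inp r1 (a1 ∷ a2 ∷ r2) s3)
  ... | no  _ = tryC s2 s3
  tryB [] _ = tryC s2 s3

algStep : Config → Step
algStep (config [] s1 s2 s3) = moveBCD [] s1 s2 s3
algStep (config (x ∷ xs) [] s2 s3) = step A (config xs (x ∷ []) s2 s3)
algStep (config (x ∷ xs) (a1 ∷ r1) s2 s3) with x <? a1
... | yes _ = step A (config xs (x ∷ a1 ∷ r1) s2 s3)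
... | no  _ = moveBCD (x ∷ xs) (a1 ∷ r1) s2 s3

run : ℕ → Config → List Move
run zero    _ = []
run (suc k) c with algStep c
... | done       = []
... | step m c'  = m ∷ run k c'

-- The 3-stack word of p: the algorithm performs exactly 4n moves
-- (n of each letter), so 4 * length p steps of fuel suffice.
threeStackWord : List ℕ → List Move
threeStackWord p = run (4 * length p) (config p [] [] [])

HasFactor : List Move → List Move → Set
HasFactor w u = ∃ λ x → ∃ λ y → w ≡ x ++ u ++ y

-- S1 and S2 stay strictly increasing, and a B or C move is made only because
-- every earlier move in the order A, B, C was blocked.  Each forbidden factor
-- then yields two opposite comparisons between the same two entries: in BB
-- (and CC) the second moved entry lies below the first in its old stack but
-- must fit on top of it in the new one; in BAB the input entry too large for
-- S1 would fit under the entry just moved to S2; in CBAʲC the entry moved by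
-- B is the one that failed to fit on the top of S2, which has become the top
-- of S3, and A moves leave S2 and S3 untouched.
module Submission where

open import Defs
open import Data.Nat using (ℕ; suc; zero; _<_; _≮_; _<?_; _*_)
open import Data.Nat.Properties using (<-asym)
open import Data.List using (List; []; _∷_; _++_; replicate; upTo; map; length; head)
open import Data.List.Relation.Binary.Permutation.Propositional using (_↭_)
open import Data.List.Relation.Unary.Linked as Linked using (Linked; []; tail; _∷′_)
open import Data.Maybe using (just; nothing)
open import Data.Maybe.Relation.Binary.Connected using (Connected; just; just-nothing; nothing-just; nothing)
open import Data.Product using (_×_; _,_; ∃)
open import Relation.Nullary using (¬_; yes; no)
open import Relation.Binary.PropositionalEquality using (_≡_; _≢_; refl)

CanPush : ℕ → Stack → Set
CanPush x s = Connected _<_ (just x) (head s)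

-- The side conditions of B and C record why the earlier moves were not taken.
infix 4 _⟶[_]_
data _⟶[_]_ : Config → Move → Config → Set where
  move-A : ∀ {x xs s1 s2 s3} → CanPush x s1 →
           config (x ∷ xs) s1 s2 s3 ⟶[ A ] config xs (x ∷ s1) s2 s3
  move-B : ∀ {inp a1 r1 s2 s3} → Connected _≮_ (head inp) (just a1) → CanPush a1 s2 →
           config inp (a1 ∷ r1) s2 s3 ⟶[ B ] config inp r1 (a1 ∷ s2) s3
  move-C : ∀ {inp s1 a2 r2 s3} → Connected _≮_ (head s1) (just a2) → CanPush a2 s3 →
           config inp s1 (a2 ∷ r2) s3 ⟶[ C ] config inp s1 r2 (a2 ∷ s3)
  move-D : ∀ {inp s1 s2 a3 r3} →
           config inp s1 s2 (a3 ∷ r3) ⟶[ D ] config inp s1 s2 r3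

moveBCD-sound : ∀ inp s1 s2 s3 {m c} → Connected _≮_ (head inp) (head s1) →
                moveBCD inp s1 s2 s3 ≡ step m c → config inp s1 s2 s3 ⟶[ m ] c
moveBCD-sound inp (a1 ∷ r1) [] s3 blocked refl = move-B blocked just-nothing
moveBCD-sound inp (a1 ∷ r1) (a2 ∷ r2) s3 blocked eq with a1 <? a2
moveBCD-sound inp (a1 ∷ r1) (a2 ∷ r2) s3 blocked refl | yes a1<a2 = move-B blocked (just a1<a2)
moveBCD-sound inp (a1 ∷ r1) (a2 ∷ r2) [] blocked refl | no a1≮a2 = move-C (just a1≮a2) just-nothing
moveBCD-sound inp (a1 ∷ r1) (a2 ∷ r2) (a3 ∷ r3) blocked eq | no a1≮a2 with a2 <? a3
moveBCD-sound inp (a1 ∷ r1) (a2 ∷ r2) (a3 ∷ r3) blocked refl | no a1≮a2 | yes a2<a3 =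
  move-C (just a1≮a2) (just a2<a3)
moveBCD-sound inp (a1 ∷ r1) (a2 ∷ r2) (a3 ∷ r3) blocked refl | no a1≮a2 | no _ = move-D
moveBCD-sound inp [] [] (a3 ∷ r3) blocked refl = move-D
moveBCD-sound inp [] (a2 ∷ r2) [] blocked refl = move-C nothing-just just-nothing
moveBCD-sound inp [] (a2 ∷ r2) (a3 ∷ r3) blocked eq with a2 <? a3
moveBCD-sound inp [] (a2 ∷ r2) (a3 ∷ r3) blocked refl | yes a2<a3 = move-C nothing-just (just a2<a3)
moveBCD-sound inp [] (a2 ∷ r2) (a3 ∷ r3) blocked refl | no _ = move-D

algStep-sound : ∀ c {m c′} → algStep c ≡ step m c′ → c ⟶[ m ] c′
algStep-sound (config [] [] s2 s3) = moveBCD-sound [] [] s2 s3 nothing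
algStep-sound (config [] (a1 ∷ r1) s2 s3) = moveBCD-sound [] (a1 ∷ r1) s2 s3 nothing-just
algStep-sound (config (x ∷ xs) [] s2 s3) refl = move-A just-nothing
algStep-sound (config (x ∷ xs) (a1 ∷ r1) s2 s3) eq with x <? a1
algStep-sound (config (x ∷ xs) (a1 ∷ r1) s2 s3) refl | yes x<a1 = move-A (just x<a1)
algStep-sound (config (x ∷ xs) (a1 ∷ r1) s2 s3) eq | no x≮a1 =
  moveBCD-sound (x ∷ xs) (a1 ∷ r1) s2 s3 (just x≮a1) eq

run-∷-inv : ∀ k c {m w} → run k c ≡ m ∷ w → ∃ λ k′ → ∃ λ c′ → c ⟶[ m ] c′ × run k′ c′ ≡ w
run-∷-inv (suc k) c eq with algStep c in e
run-∷-inv (suc k) c refl | step m c′ = k , c′ , algStep-sound c e , refl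

Increasing : Config → Set
Increasing (config _ s1 s2 _) = Linked _<_ s1 × Linked _<_ s2

⟶-increasing : ∀ {c m c′} → c ⟶[ m ] c′ → Increasing c → Increasing c′
⟶-increasing (move-A x◁s1) (inc1 , inc2) = x◁s1 ∷′ inc1 , inc2
⟶-increasing (move-B _ a1◁s2) (inc1 , inc2) = tail inc1 , a1◁s2 ∷′ inc2
⟶-increasing (move-C _ _) (inc1 , inc2) = inc1 , tail inc2
⟶-increasing move-D inc = inc

run-++-inv : ∀ x k c {v} → Increasing c → run k c ≡ x ++ v →
             ∃ λ k′ → ∃ λ c′ → Increasing c′ × run k′ c′ ≡ v
run-++-inv [] k c inc eq = k , c , inc , eq
run-++-inv (m ∷ x) k c inc eq with run-∷-inv k c eq
... | k′ , c′ , c⟶c′ , eq′ = run-++-inv x k′ c′ (⟶-increasing c⟶c′ inc) eq′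

Forbidden : List Move → Set
Forbidden u = ∀ k c y → Increasing c → run k c ≢ u ++ y

forbidden⇒¬factor : ∀ {u} → Forbidden u → ∀ p → ¬ HasFactor (threeStackWord p) u
forbidden⇒¬factor forbidden p (x , y , eq)
  with run-++-inv x (4 * length p) (config p [] [] []) ([] , []) eq
... | k , c , inc , eq′ = forbidden k c y inc eq′

BB-forbidden : Forbidden (B ∷ B ∷ [])
BB-forbidden k c y (inc1 , _) eq with run-∷-inv k c eq
... | k1 , c1 , move-B _ _ , eq1 with run-∷-inv k1 c1 eq1
... | _ , _ , move-B _ (just a1′<a1) , _ = <-asym (Linked.head inc1) a1′<a1

CC-forbidden : Forbidden (C ∷ C ∷ [])
CC-forbidden k c y (_ , inc2) eq with run-∷-inv k c eq
... | k1 , c1 , move-C _ _ , eq1 with run-∷-inv k1 c1 eq1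
... | _ , _ , move-C _ (just a2′<a2) , _ = <-asym (Linked.head inc2) a2′<a2

BAB-forbidden : Forbidden (B ∷ A ∷ B ∷ [])
BAB-forbidden k c y _ eq with run-∷-inv k c eq
... | k1 , c1 , move-B x≮a1 _ , eq1 with run-∷-inv k1 c1 eq1
... | k2 , c2 , move-A _ , eq2 with run-∷-inv k2 c2 eq2
... | _ , _ , move-B _ (just x<a1) , _ with x≮a1
... | just x≮a1′ = x≮a1′ x<a1

AʲC-blocked : ∀ j k {inp s1 a2 r2 a3 r3} y → a2 ≮ a3 →
              run k (config inp s1 (a2 ∷ r2) (a3 ∷ r3)) ≢ (replicate j A ++ C ∷ []) ++ y
AʲC-blocked zero k y a2≮a3 eq with run-∷-inv k _ eq
... | _ , _ , move-C _ (just a2<a3) , _ = a2≮a3 a2<a3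
AʲC-blocked (suc j) k y a2≮a3 eq with run-∷-inv k _ eq
... | k′ , _ , move-A _ , eq′ = AʲC-blocked j k′ y a2≮a3 eq′

CBAʲC-forbidden : ∀ j → Forbidden (C ∷ B ∷ replicate j A ++ C ∷ [])
CBAʲC-forbidden j k c y _ eq with run-∷-inv k c eq
... | k1 , c1 , move-C a1≮a2 _ , eq1 with run-∷-inv k1 c1 eq1
... | k2 , _ , move-B _ _ , eq2 with a1≮a2
... | just a1≮a2′ = AʲC-blocked j k2 y a1≮a2′ eq2

mainTheorem2 : (n : ℕ) (p : List ℕ) → p ↭ map suc (upTo n) →
    let w = threeStackWord p in
    ¬ HasFactor w (B ∷ B ∷ [])
    × ¬ HasFactor w (C ∷ C ∷ [])
    × ¬ HasFactor w (B ∷ A ∷ B ∷ [])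
    × ((j : ℕ) → ¬ HasFactor w (C ∷ B ∷ replicate j A ++ C ∷ []))
mainTheorem2 _ p _ =
    forbidden⇒¬factor BB-forbidden p
  , forbidden⇒¬factor CC-forbidden p
  , forbidden⇒¬factor BAB-forbidden p
  , λ j → forbidden⇒¬factor (CBAʲC-forbidden j) p
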